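{- Let $\mathcal{A}\subset S_n$ be a strong up-set and for $k\in[n]$ let \[ \mathcal{A}_k:=\{(a_1,\dots,a_{n-1})\in S_{n-1}:(a_1,\dots,a_{k-1},n,a_k,\dots,a_{n-1})\in\mathcal{A}\}. \] Then (i) $\mathcal{A}_k$ is a strong up-set in $S_{n-1}$ for every $k\in[n]$, and (ii) $\mathcal{A}_1\subset\mathcal{A}_2\subset\cdots\subset\mathcal{A}_n$.
   Context: Elements of $S_m$ are $m$-tuples $\mathbf{a}=(a_1,\dots,a_m)$ of distinct elements of $[m]$; $\mathrm{pos}(\mathbf{a},i)=k$ if $a_k=i$. For $1\le i<j\le m$, $\{i,j\}$ is an inversion of $\mathbf{a}$ if $\mathrm{pos}(\mathbf{a},i)>\mathrm{pos}(\mathbf{a},j)$. A family $\mathcal{A}\subset S_m$ is a strong up-set if whenever $\mathbf{a}\in\mathcal{A}$ and $\{i,j\}$ is an inversion of $\mathbf{a}$, the permutation obtained by swapping the entries $i$ and $j$ is in $\mathcal{A}$. -}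

module Defs where

open import Data.Nat using (ℕ; suc)
open import Data.Fin using (Fin; _<_; inject₁; fromℕ; suc; _≟_)
open import Data.Vec using (Vec; lookup; map; insertAt)
open import Data.Product using (∃₂; _×_)
open import Relation.Binary.PropositionalEquality using (_≡_)
open import Relation.Nullary using (yes; no)

-- An element of S_m: an m-tuple (a_1,...,a_m) of elements of [m] (encoded as Fin m,
-- value v ↦ v+1, position k ↦ k+1) whose entries are distinct.
IsPerm : ∀ {m} → Vec (Fin m) m → Set
IsPerm {m} a = ∀ (k l : Fin m) → lookup a k ≡ lookup a l → k ≡ l

IsInversion : ∀ {m} → Vec (Fin m) m → Fin m → Fin m → Set
IsInversion {m} a i j =
  i < j × ∃₂ λ (k l : Fin m) → lookup a k ≡ i × lookup a l ≡ j × l < k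

transposeVal : ∀ {m} → Fin m → Fin m → Fin m → Fin m
transposeVal i j x with x ≟ i
... | yes _ = j
... | no _ with x ≟ j
...   | yes _ = i
...   | no _ = x

swapEntries : ∀ {m} → Vec (Fin m) m → Fin m → Fin m → Vec (Fin m) m
swapEntries a i j = map (transposeVal i j) a

IsFamily : ∀ {m} → (Vec (Fin m) m → Set) → Set
IsFamily {m} A = ∀ a → A a → IsPerm a

IsStrongUpSet : ∀ {m} → (Vec (Fin m) m → Set) → Set
IsStrongUpSet {m} A =
  IsFamily A ×
  (∀ a → A a → ∀ i j → IsInversion a i j → A (swapEntries a i j))

-- A_k for A ⊂ S_n with n = suc m and k ∈ [n] (k : Fin (suc m), position k+1):
-- tuples a ∈ S_{n-1} such that (a_1,...,a_{k-1}, n, a_k, ..., a_{n-1}) ∈ A.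
slice : ∀ {m} → (Vec (Fin (suc m)) (suc m) → Set) → Fin (suc m) → Vec (Fin m) m → Set
slice {m} A k a = IsPerm a × A (insertAt (map inject₁ a) k (fromℕ m))

module Submission where

open import Defs
open import Data.Nat using (ℕ; suc; s≤s; z≤n)
import Data.Nat as ℕ
open import Data.Fin using (Fin; zero; suc; inject₁; fromℕ; punchIn; toℕ; _≟_; _<_)
open import Data.Fin.Properties
  using (suc-injective; inject₁-injective; fromℕ≢inject₁; toℕ-inject₁; toℕ-fromℕ;
         inject₁ℕ<; ≤̄⇒inject₁<; ≤-refl)
open import Data.Vec using (Vec; []; _∷_; lookup; map; insertAt)
open import Data.Vec.Properties using (lookup-map; map-∘; map-cong; map-insertAt; insertAt-lookup; insertAt-punchIn)
open import Data.Product using (_×_; _,_; proj₁)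
open import Data.Empty using (⊥-elim)
open import Function using (_∘_)
open import Relation.Binary.PropositionalEquality
open import Relation.Nullary using (yes; no; ¬_)

{-
Inserting the maximal value n at position k is compatible with the order of the
other values, so an inversion {i,j} of a ∈ S_{n-1} is still an inversion of the
lifted permutation, and swapping i and j commutes with the insertion; this gives (i).
For (ii), n at position k followed by a_k forms the inversion {a_k, n}, and swapping
these two values moves n one place to the right, from position k to k+1.
-}

module _ {n : ℕ} where

  transposeVal-left : (i j : Fin n) → transposeVal i j i ≡ j
  transposeVal-left i j with i ≟ i
  ... | yes _ = refl
  ... | no i≢i = ⊥-elim (i≢i refl)

  transposeVal-right : (i j : Fin n) → transposeVal i j j ≡ i
  transposeVal-right i j with j ≟ i
  ... | yes j≡i = j≡i
  ... | no _ with j ≟ j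
  ...   | yes _ = refl
  ...   | no j≢j = ⊥-elim (j≢j refl)

  transposeVal-fixes : (i j x : Fin n) → ¬ x ≡ i → ¬ x ≡ j → transposeVal i j x ≡ x
  transposeVal-fixes i j x x≢i x≢j with x ≟ i
  ... | yes x≡i = ⊥-elim (x≢i x≡i)
  ... | no _ with x ≟ j
  ...   | yes x≡j = ⊥-elim (x≢j x≡j)
  ...   | no _ = refl

  transposeVal-involutive : (i j x : Fin n) → transposeVal i j (transposeVal i j x) ≡ x
  transposeVal-involutive i j x with x ≟ i
  ... | yes refl = transposeVal-right i j
  ... | no x≢i with x ≟ j
  ...   | yes refl = transposeVal-left i j
  ...   | no x≢j = transposeVal-fixes i j x x≢i x≢j

transposeVal-inject₁ : ∀ {n} (i j x : Fin n) →
  transposeVal (inject₁ i) (inject₁ j) (inject₁ x) ≡ inject₁ (transposeVal i j x)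
transposeVal-inject₁ i j x with x ≟ i
... | yes refl = transposeVal-left (inject₁ x) (inject₁ j)
... | no x≢i with x ≟ j
...   | yes refl = transposeVal-right (inject₁ i) (inject₁ x)
...   | no x≢j = transposeVal-fixes _ _ _ (x≢i ∘ inject₁-injective) (x≢j ∘ inject₁-injective)

swapEntries-isPerm : ∀ {m} (a : Vec (Fin m) m) (i j : Fin m) → IsPerm a → IsPerm (swapEntries a i j)
swapEntries-isPerm a i j a-perm k l eq = a-perm k l (begin
  lookup a k                          ≡⟨ sym (transposeVal-involutive i j _) ⟩
  τ (τ (lookup a k))                  ≡⟨ cong τ (sym (lookup-map k τ a)) ⟩
  τ (lookup (swapEntries a i j) k)    ≡⟨ cong τ eq ⟩
  τ (lookup (swapEntries a i j) l)    ≡⟨ cong τ (lookup-map l τ a) ⟩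
  τ (τ (lookup a l))                  ≡⟨ transposeVal-involutive i j _ ⟩
  lookup a l                          ∎)
  where
  open ≡-Reasoning
  τ : Fin _ → Fin _
  τ = transposeVal i j

inject₁-mono-< : ∀ {n} {i j : Fin n} → i < j → inject₁ i < inject₁ j
inject₁-mono-< {i = i} {j} = subst₂ ℕ._<_ (sym (toℕ-inject₁ i)) (sym (toℕ-inject₁ j))

inject₁<fromℕ : ∀ {n} (i : Fin n) → inject₁ i < fromℕ n
inject₁<fromℕ {n} i = subst (toℕ (inject₁ i) ℕ.<_) (sym (toℕ-fromℕ n)) (inject₁ℕ< i)

punchIn-mono-< : ∀ {n} (i : Fin (suc n)) (j k : Fin n) → j < k → punchIn i j < punchIn i k
punchIn-mono-< zero    j       k       j<k       = s≤s j<k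
punchIn-mono-< (suc i) zero    (suc k) _         = s≤s z≤n
punchIn-mono-< (suc i) (suc j) (suc k) (s≤s j<k) = s≤s (punchIn-mono-< i j k j<k)

punchIn-inject₁-self : ∀ {n} (k : Fin n) → punchIn (inject₁ k) k ≡ suc k
punchIn-inject₁-self zero    = refl
punchIn-inject₁-self (suc k) = cong suc (punchIn-inject₁-self k)

map-insertAt-inject₁ : ∀ {A : Set} {n} (f : A → A) (v : Vec A n) (k : Fin n) (y : A) →
  f y ≡ lookup v k → f (lookup v k) ≡ y → (∀ p → ¬ p ≡ k → f (lookup v p) ≡ lookup v p) →
  map f (insertAt v (inject₁ k) y) ≡ insertAt v (suc k) y
map-insertAt-inject₁ f (x ∷ v) zero y fy≡x fx≡y fixes =
  cong₂ _∷_ fy≡x (cong₂ _∷_ fx≡y (map-fixed v (λ p → fixes (suc p) λ ())))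
  where
  map-fixed : ∀ {n} (w : Vec _ n) → (∀ p → f (lookup w p) ≡ lookup w p) → map f w ≡ w
  map-fixed []      _     = refl
  map-fixed (z ∷ w) fixed = cong₂ _∷_ (fixed zero) (map-fixed w (fixed ∘ suc))
map-insertAt-inject₁ f (x ∷ v) (suc k) y fy≡x fx≡y fixes =
  cong₂ _∷_ (fixes zero λ ())
            (map-insertAt-inject₁ f v k y fy≡x fx≡y (λ p p≢k → fixes (suc p) (p≢k ∘ suc-injective)))

insertTop : ∀ {m} → Fin (suc m) → Vec (Fin m) m → Vec (Fin (suc m)) (suc m)
insertTop {m} k a = insertAt (map inject₁ a) k (fromℕ m)

module _ {m : ℕ} where

  lookup-insertTop-punchIn : (k : Fin (suc m)) (a : Vec (Fin m) m) (r : Fin m) →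
    lookup (insertTop k a) (punchIn k r) ≡ inject₁ (lookup a r)
  lookup-insertTop-punchIn k a r =
    trans (insertAt-punchIn (map inject₁ a) k (fromℕ m) r) (lookup-map r inject₁ a)

  insertTop-inversion : (k : Fin (suc m)) (a : Vec (Fin m) m) {i j : Fin m} →
    IsInversion a i j → IsInversion (insertTop k a) (inject₁ i) (inject₁ j)
  insertTop-inversion k a (i<j , p , q , a[p]≡i , a[q]≡j , q<p) =
    inject₁-mono-< i<j , punchIn k p , punchIn k q
    , trans (lookup-insertTop-punchIn k a p) (cong inject₁ a[p]≡i)
    , trans (lookup-insertTop-punchIn k a q) (cong inject₁ a[q]≡j)
    , punchIn-mono-< k q p q<p

  swapEntries-insertTop : (k : Fin (suc m)) (a : Vec (Fin m) m) (i j : Fin m) →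
    swapEntries (insertTop k a) (inject₁ i) (inject₁ j) ≡ insertTop k (swapEntries a i j)
  swapEntries-insertTop k a i j = begin
    map τ′ (insertAt (map inject₁ a) k (fromℕ m))  ≡⟨ map-insertAt τ′ (fromℕ m) (map inject₁ a) k ⟩
    insertAt (map τ′ (map inject₁ a)) k (τ′ (fromℕ m))
      ≡⟨ cong₂ (λ v x → insertAt v k x) τ′-map-inject₁ τ′-top ⟩
    insertAt (map inject₁ (map τ a)) k (fromℕ m)   ∎
    where
    open ≡-Reasoning
    τ = transposeVal i j
    τ′ = transposeVal (inject₁ i) (inject₁ j)
    τ′-map-inject₁ : map τ′ (map inject₁ a) ≡ map inject₁ (map τ a)
    τ′-map-inject₁ = begin
      map τ′ (map inject₁ a)    ≡⟨ sym (map-∘ τ′ inject₁ a) ⟩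
      map (τ′ ∘ inject₁) a      ≡⟨ map-cong (transposeVal-inject₁ i j) a ⟩
      map (inject₁ ∘ τ) a       ≡⟨ map-∘ inject₁ τ a ⟩
      map inject₁ (map τ a)     ∎
    τ′-top : τ′ (fromℕ m) ≡ fromℕ m
    τ′-top = transposeVal-fixes _ _ _ fromℕ≢inject₁ fromℕ≢inject₁

  insertTop-inject₁-inversion : (k : Fin m) (a : Vec (Fin m) m) →
    IsInversion (insertTop (inject₁ k) a) (inject₁ (lookup a k)) (fromℕ m)
  insertTop-inject₁-inversion k a =
    inject₁<fromℕ (lookup a k) , suc k , inject₁ k
    , trans (cong (lookup (insertTop (inject₁ k) a)) (sym (punchIn-inject₁-self k)))
            (lookup-insertTop-punchIn (inject₁ k) a k)
    , insertAt-lookup (map inject₁ a) (inject₁ k) (fromℕ m)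
    , ≤̄⇒inject₁< ≤-refl

  swapEntries-insertTop-inject₁ : (k : Fin m) (a : Vec (Fin m) m) → IsPerm a →
    swapEntries (insertTop (inject₁ k) a) (inject₁ (lookup a k)) (fromℕ m) ≡ insertTop (suc k) a
  swapEntries-insertTop-inject₁ k a a-perm =
    map-insertAt-inject₁ τ (map inject₁ a) k (fromℕ m)
      (trans (transposeVal-right x (fromℕ m)) (sym (lookup-map k inject₁ a)))
      (trans (cong τ (lookup-map k inject₁ a)) (transposeVal-left x (fromℕ m)))
      τ-fixes
    where
    x = inject₁ (lookup a k)
    τ = transposeVal x (fromℕ m)
    τ-fixes : ∀ p → ¬ p ≡ k → τ (lookup (map inject₁ a) p) ≡ lookup (map inject₁ a) p
    τ-fixes p p≢k rewrite lookup-map p inject₁ a =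
      transposeVal-fixes x (fromℕ m) _
        (λ eq → p≢k (a-perm p k (inject₁-injective eq)))
        (λ eq → fromℕ≢inject₁ (sym eq))

slice-isStrongUpSet : ∀ {m} (A : Vec (Fin (suc m)) (suc m) → Set) →
  IsStrongUpSet A → (k : Fin (suc m)) → IsStrongUpSet (slice A k)
slice-isStrongUpSet A (_ , up) k = (λ _ → proj₁) , swap-closed
  where
  swap-closed : ∀ a → slice A k a → ∀ i j → IsInversion a i j → slice A k (swapEntries a i j)
  swap-closed a (a-perm , A-lift) i j inv =
    swapEntries-isPerm a i j a-perm
    , subst A (swapEntries-insertTop k a i j)
        (up (insertTop k a) A-lift (inject₁ i) (inject₁ j) (insertTop-inversion k a inv))

slice-inject₁⊆slice-suc : ∀ {m} (A : Vec (Fin (suc m)) (suc m) → Set) → IsStrongUpSet A →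
  (k : Fin m) (a : Vec (Fin m) m) → slice A (inject₁ k) a → slice A (suc k) a
slice-inject₁⊆slice-suc A (_ , up) k a (a-perm , A-lift) =
  a-perm
  , subst A (swapEntries-insertTop-inject₁ k a a-perm)
      (up _ A-lift _ _ (insertTop-inject₁-inversion k a))

lemma1 : (m : ℕ) (A : Vec (Fin (suc m)) (suc m) → Set) →
    IsStrongUpSet A →
    ((k : Fin (suc m)) → IsStrongUpSet (slice A k)) ×
    ((k : Fin m) (a : Vec (Fin m) m) → slice A (inject₁ k) a → slice A (suc k) a)
lemma1 m A A-up = slice-isStrongUpSet A A-up , slice-inject₁⊆slice-suc A A-up
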